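{- Let $m\in\mathbb{N}$ and let $G$ be a graph of doubling dimension at most $m$. Suppose that for some $r\in\mathbb{N}_{>0}$ the graph $G$ has distance-$r$ balanced separator number at most $k$. Then for every inclusion-wise maximal distance-$r$ independent set $I$ in $G$, the distance graph $H(G,I,r,3)$ has treewidth at most $3k\cdot2^{6m}$.
   Context: Graphs are finite and simple, $\mathrm{dist}_G$ is shortest-path distance, $\mathrm{Ball}_G(u,r)=\{v:\mathrm{dist}_G(u,v)\le r\}$. $G$ has doubling dimension at most $m$ if for every real $r\ge0$ every radius-$2r$ ball of $G$ can be covered by $2^m$ radius-$r$ balls. A set is $(k,r)$-coverable if it is contained in the union of $k$ radius-$r$ balls of $G$. For $\mu:V(G)\to\mathbb{R}_{\ge0}$, $X\subseteq V(G)$ is a balanced separator for $\mu$ if every connected component $C$ of $G-X$ has $\mu(V(C))\le\frac12\mu(V(G))$; the distance-$r$ balanced separator number of $G$ is the smallest $k$ such that every such $\mu$ admits a $(k,r)$-coverable balanced separator. A distance-$r$ independent set is $I\subseteq V(G)$ with $\mathrm{dist}_G(u,v)>r$ for distinct $u,v\in I$. The distance graph $H(G,I,r,\sigma)$ is the edge-weighted graph on vertex set $I$ where distinct $u,v\in I$ are joined by an edge of weight $\sigma r$ whenever $\mathrm{dist}_G(u,v)\le\sigma r$; its treewidth is that of its underlying graph. -}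

module Defs where

open import Data.Nat as ℕ using (ℕ; zero; suc; _^_; ⌊_/2⌋)
open import Data.Fin using (Fin; zero; suc; toℕ; _≟_)
open import Data.Fin.Subset using (Subset; _∈_; _∉_; _⊆_; ⊤; ∣_∣)
open import Data.Bool using (Bool; true; false; _∨_)
open import Data.List using (List; length)
open import Data.List.Membership.Propositional using () renaming (_∈_ to _∈ₗ_)
open import Data.Vec using ([]; _∷_)
open import Data.Product using (Σ; ∃; ∃-syntax; _×_; _,_)
open import Data.Rational as ℚ using (ℚ; 0ℚ; ½)
open import Relation.Binary.PropositionalEquality using (_≡_; _≢_)
open import Relation.Nullary using (¬_)
open import Relation.Nullary.Decidable using (⌊_⌋)

record Graph : Set where
  field
    n     : ℕ
    adj   : Fin n → Fin n → Bool
    sym   : ∀ u v → adj u v ≡ adj v u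
    irrefl : ∀ u → adj u u ≡ false
open Graph public

data WalkIn {n : ℕ} (A : Fin n → Fin n → Bool) (S : Fin n → Set)
     : Fin n → Fin n → ℕ → Set where
  here : ∀ {u} → S u → WalkIn A S u u zero
  step : ∀ {u w v ℓ} → S u → A u w ≡ true → WalkIn A S w v ℓ
       → WalkIn A S u v (suc ℓ)

-- dist_G(u,v) ≤ d  (false if u,v lie in different components: dist = ∞)
DistLe : (G : Graph) → Fin (n G) → Fin (n G) → ℕ → Set
DistLe G u v d = ∃[ ℓ ] (ℓ ℕ.≤ d × WalkIn (adj G) (λ _ → Data.Unit.⊤) u v ℓ)
  where import Data.Unit

InBall : (G : Graph) → Fin (n G) → ℕ → Fin (n G) → Set
InBall G c d v = DistLe G c v d

CoveredBy : (G : Graph) → List (Fin (n G)) → ℕ → (Fin (n G) → Set) → Set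
CoveredBy G cs d X = ∀ v → X v → ∃[ c ] (c ∈ₗ cs × InBall G c d v)

Coverable : (G : Graph) → ℕ → ℕ → Subset (n G) → Set
Coverable G k d X =
  ∃[ cs ] (length cs ℕ.≤ k × CoveredBy G cs d (λ v → v ∈ X))

-- Since distances are integers, a ball of real
-- radius ρ equals the ball of radius ⌊ρ⌋; for real r ≥ 0 put s = ⌊2r⌋, then
-- ⌊r⌋ = ⌊s/2⌋, and every s ∈ ℕ arises (r = s/2).
DoublingDimAtMost : Graph → ℕ → Set
DoublingDimAtMost G m = ∀ (u : Fin (n G)) (s : ℕ) →
  ∃[ cs ] (length cs ℕ.≤ 2 ^ m × CoveredBy G cs ⌊ s /2⌋ (InBall G u s))

sumOver : ∀ {n} → (Fin n → ℚ) → Subset n → ℚ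
sumOver {zero}  μ []          = 0ℚ
sumOver {suc n} μ (true ∷ p)  = μ zero ℚ.+ sumOver (λ i → μ (suc i)) p
sumOver {suc n} μ (false ∷ p) = sumOver (λ i → μ (suc i)) p

IsComponentOf- : (G : Graph) → Subset (n G) → Subset (n G) → Set
IsComponentOf- G X C =
  (∃[ v ] v ∈ C) ×
  (∀ v → v ∈ C → v ∉ X) ×
  (∀ u v → u ∈ C → v ∈ C → ∃[ ℓ ] WalkIn (adj G) (λ w → w ∈ C) u v ℓ) ×
  (∀ u v → u ∈ C → v ∉ X → adj G u v ≡ true → v ∈ C)

IsBalancedSeparator : (G : Graph) → (Fin (n G) → ℚ) → Subset (n G) → Set
IsBalancedSeparator G μ X =
  ∀ C → IsComponentOf- G X C → sumOver μ C ℚ.≤ ½ ℚ.* sumOver μ ⊤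

BalSepNumAtMost : (G : Graph) → ℕ → ℕ → Set
BalSepNumAtMost G r k =
  ∀ (μ : Fin (n G) → ℚ) → (∀ v → 0ℚ ℚ.≤ μ v) →
  ∃[ X ] (Coverable G k r X × IsBalancedSeparator G μ X)

DistIndependent : (G : Graph) → ℕ → Subset (n G) → Set
DistIndependent G r I =
  ∀ u v → u ∈ I → v ∈ I → u ≢ v → ¬ DistLe G u v r

MaximalDistIndependent : (G : Graph) → ℕ → Subset (n G) → Set
MaximalDistIndependent G r I =
  DistIndependent G r I × (∀ J → I ⊆ J → DistIndependent G r J → J ≡ I)

-- Edge relation of the distance graph H(G,I,r,σ) (on vertex set I, between
-- distinct vertices): dist_G(u,v) ≤ σ r.  Edge weights are irrelevant to
-- treewidth.
DistGraphEdge : (G : Graph) → ℕ → ℕ → Fin (n G) → Fin (n G) → Set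
DistGraphEdge G r σ u v = DistLe G u v (σ ℕ.* r)

-- A finite tree with node set Fin (suc t), given by parent pointers:
-- node (suc i) has parent (parent i) with index ≤ i (node 0 is the root).
treeAdj : ∀ {t} → (Fin t → Fin (suc t)) → Fin (suc t) → Fin (suc t) → Bool
treeAdj parent a b = isParent a b ∨ isParent b a
  where
  isParent : Fin _ → Fin _ → Bool
  isParent zero    y = false
  isParent (suc i) y = ⌊ parent i ≟ y ⌋

record TreeDecomposition {n : ℕ} (V : Subset n) (E : Fin n → Fin n → Set)
                         (w : ℕ) : Set where
  field
    t         : ℕ
    parent    : Fin t → Fin (suc t)
    parent<   : ∀ i → toℕ (parent i) ℕ.≤ toℕ i
    bag       : Fin (suc t) → Subset n
    bag⊆V     : ∀ a → bag a ⊆ V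
    vertexCov : ∀ v → v ∈ V → ∃[ a ] v ∈ bag a
    edgeCov   : ∀ u v → u ∈ V → v ∈ V → u ≢ v → E u v →
                ∃[ a ] (u ∈ bag a × v ∈ bag a)
    coherent  : ∀ v a b → v ∈ bag a → v ∈ bag b →
                ∃[ ℓ ] WalkIn (treeAdj parent) (λ c → v ∈ bag c) a b ℓ
    width≤    : ∀ a → ∣ bag a ∣ ℕ.≤ suc w

TreewidthAtMost : ∀ {n : ℕ} → Subset n → (Fin n → Fin n → Set) → ℕ → Set
TreewidthAtMost V E w = TreeDecomposition V E w

module Submission where

-- By the Robertson–Seymour construction, H has treewidth at most 3s as soon as every set W of vertices
-- has a separator S, ∣ S ∣ ≤ s, such that each component of H − S meets at most half of W: to decompose U
-- with a prescribed W, ∣ W ∣ ≤ 2s + 1, in the root bag, enlarge W to W′ with ∣ W′ ∣ = 2s + 1, put W′ ∪ S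
-- into the root bag (S separating W′), and recurse on C ∪ S with (W′ ∩ C) ∪ S for every component C of
-- U − S; as ∣ W′ ∩ C ∣ ≤ s, each C ∪ S misses a vertex of W′ and so is smaller than U.
-- Such an S comes from a balanced separator X of G for the weight 1_W, covered by k balls B(c, r): take
-- the vertices of I within distance 4r of the centres. An edge of H is a G-walk of length at most 3r,
-- which can only meet X if its start is within 4r of a centre, so walks in H − S stay in one component
-- of G − X. Halving the radius three times with the doubling property covers S by k·2^(3m) balls of
-- radius ⌊r/2⌋, each holding at most one vertex of the r-independent set I.

open import Defs
open import Data.Nat using (ℕ; _≤_; _*_; _^_)
open import Data.Fin.Subset using (Subset)

open import Data.Bool as Bool using (Bool; true; false; if_then_else_)
import Data.Bool.Properties as Boolₚ
open import Data.Empty using (⊥-elim)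
open import Data.Fin as Fin using (Fin; zero; suc; toℕ; _↑ˡ_; _↑ʳ_; splitAt)
import Data.Fin.Properties as Finₚ
open import Data.Fin.Subset using (_∈_; _∉_; _⊆_; _∪_; _∩_; _─_; ∣_∣; ⁅_⁆; ⊥; ⊤; ∁; Empty)
open import Data.Fin.Subset.Properties
import Data.Integer as ℤ
import Data.Integer.Properties as ℤₚ
open import Data.List using (List; []; _∷_; length; concatMap)
import Data.List.Properties as Listₚ
open import Data.List.Membership.Propositional using (find; lose) renaming (_∈_ to _∈ₗ_)
open import Data.List.Membership.Propositional.Properties using (∈-concatMap⁺)
open import Data.List.Relation.Unary.Any as Any using (Any; here; there)
open import Data.Nat using (zero; suc; _+_; _<_; z≤n; s≤s; ⌊_/2⌋)
import Data.Nat.Properties as ℕₚ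
open import Data.Nat.Tactic.RingSolver using (solve-∀)
open import Data.Product using (∃-syntax; _×_; _,_; proj₁; proj₂)
open import Data.Rational as ℚ using (ℚ; 0ℚ; 1ℚ; ½)
import Data.Rational.Properties as ℚₚ
open import Data.Rational.Unnormalised as ℚᵘ using (ℚᵘ; mkℚᵘ; _≃_)
import Data.Rational.Unnormalised.Properties as ℚᵘₚ
open import Data.Sum as Sum using (_⊎_; inj₁; inj₂; [_,_]′)
open import Data.Unit using (tt) renaming (⊤ to Unit)
open import Data.Vec using (tabulate; lookup; []; _∷_; here; there)
import Data.Vec.Properties as Vecₚ
open import Function using (_∘_; id)
open import Function.Bundles using (mk⇔)
open import Relation.Binary.PropositionalEquality as ≡
  using (_≡_; _≢_; refl; trans; cong; cong₂; subst; subst₂; module ≡-Reasoning)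
open import Relation.Nullary using (Dec; yes; no; does)
open import Relation.Nullary.Decidable
  using (⌊_⌋; map′; _×-dec_; _⊎-dec_; dec-true; does-⇔; decidable-stable)

-- Finite subsets

does≡true⇒ : ∀ {P : Set} (P? : Dec P) → does P? ≡ true → P
does≡true⇒ (yes p) _ = p

module _ {n : ℕ} {P : Fin n → Set} (P? : ∀ x → Dec (P x)) where

  subset : Subset n
  subset = tabulate (does ∘ P?)

  ∈-subset⁺ : ∀ {x} → P x → x ∈ subset
  ∈-subset⁺ {x} px = Vecₚ.lookup⇒[]= x _ (trans (Vecₚ.lookup∘tabulate _ x) (dec-true (P? x) px))

  ∈-subset⁻ : ∀ {x} → x ∈ subset → P x
  ∈-subset⁻ {x} x∈ = does≡true⇒ (P? x) (trans (≡.sym (Vecₚ.lookup∘tabulate _ x)) (Vecₚ.[]=⇒lookup x∈))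

x∈p─q⇒x∉q : ∀ {n} (p q : Subset n) {x} → x ∈ p ─ q → x ∉ q
x∈p─q⇒x∉q (true ∷ p) (false ∷ q) here ()
x∈p─q⇒x∉q (_ ∷ p) (true ∷ q) (there x∈) (there x∈q) = x∈p─q⇒x∉q p q x∈ x∈q
x∈p─q⇒x∉q (_ ∷ p) (false ∷ q) (there x∈) (there x∈q) = x∈p─q⇒x∉q p q x∈ x∈q

∣p∪q∣≤∣p∣+∣q∣ : ∀ {n} (p q : Subset n) → ∣ p ∪ q ∣ ≤ ∣ p ∣ + ∣ q ∣
∣p∪q∣≤∣p∣+∣q∣ [] [] = z≤n
∣p∪q∣≤∣p∣+∣q∣ (true ∷ p) (true ∷ q) =
  s≤s (ℕₚ.≤-trans (ℕₚ.m≤n⇒m≤1+n (∣p∪q∣≤∣p∣+∣q∣ p q)) (ℕₚ.≤-reflexive (≡.sym (ℕₚ.+-suc ∣ p ∣ ∣ q ∣))))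
∣p∪q∣≤∣p∣+∣q∣ (true ∷ p) (false ∷ q) = s≤s (∣p∪q∣≤∣p∣+∣q∣ p q)
∣p∪q∣≤∣p∣+∣q∣ (false ∷ p) (true ∷ q) =
  ℕₚ.≤-trans (s≤s (∣p∪q∣≤∣p∣+∣q∣ p q)) (ℕₚ.≤-reflexive (≡.sym (ℕₚ.+-suc ∣ p ∣ ∣ q ∣)))
∣p∪q∣≤∣p∣+∣q∣ (false ∷ p) (false ∷ q) = ∣p∪q∣≤∣p∣+∣q∣ p q

p⊆q∪r⇒∣p∣≤∣q∣+∣r∣ : ∀ {n} {p : Subset n} (q r : Subset n) → p ⊆ q ∪ r → ∣ p ∣ ≤ ∣ q ∣ + ∣ r ∣
p⊆q∪r⇒∣p∣≤∣q∣+∣r∣ q r p⊆q∪r = ℕₚ.≤-trans (p⊆q⇒∣p∣≤∣q∣ p⊆q∪r) (∣p∪q∣≤∣p∣+∣q∣ q r)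

p⊆p∩q∪p─q : ∀ {n} (p q : Subset n) → p ⊆ (p ∩ q) ∪ (p ─ q)
p⊆p∩q∪p─q p q {x} x∈p with x ∈? q
... | yes x∈q = p⊆p∪q (p ─ q) (x∈p∩q⁺ (x∈p , x∈q))
... | no x∉q = q⊆p∪q (p ∩ q) (p ─ q) (x∈p∧x∉q⇒x∈p─q x∈p x∉q)

∪-lub : ∀ {n} {p q r : Subset n} → p ⊆ r → q ⊆ r → p ∪ q ⊆ r
∪-lub {p = p} {q} p⊆r q⊆r x∈p∪q with x∈p∪q⁻ p q x∈p∪q
... | inj₁ x∈p = p⊆r x∈p
... | inj₂ x∈q = q⊆r x∈q

x∈p∪r⇒x∈q∪r⇒x∈p∩q∪r : ∀ {n} {p q r : Subset n} {x} → x ∈ p ∪ r → x ∈ q ∪ r → x ∈ (p ∩ q) ∪ r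
x∈p∪r⇒x∈q∪r⇒x∈p∩q∪r {p = p} {q} {r} x∈p∪r x∈q∪r with x∈p∪q⁻ p r x∈p∪r | x∈p∪q⁻ q r x∈q∪r
... | inj₂ x∈r | _ = q⊆p∪q (p ∩ q) r x∈r
... | _ | inj₂ x∈r = q⊆p∪q (p ∩ q) r x∈r
... | inj₁ x∈p | inj₁ x∈q = p⊆p∪q r (x∈p∩q⁺ (x∈p , x∈q))

all-equal⇒∣p∣≤1 : ∀ {n} (p : Subset n) → (∀ {x y} → x ∈ p → y ∈ p → x ≡ y) → ∣ p ∣ ≤ 1
all-equal⇒∣p∣≤1 {n} p all-equal with nonempty? p
... | no p≡∅ = ℕₚ.≤-trans (ℕₚ.≤-reflexive (trans (cong ∣_∣ (Empty-unique p≡∅)) (∣⊥∣≡0 n))) z≤n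
... | yes (x , x∈p) = ℕₚ.≤-trans (p⊆q⇒∣p∣≤∣q∣ p⊆⁅x⁆) (ℕₚ.≤-reflexive (∣⁅x⁆∣≡1 x))
  where
  p⊆⁅x⁆ : p ⊆ ⁅ x ⁆
  p⊆⁅x⁆ y∈p = subst (_∈ ⁅ x ⁆) (all-equal x∈p y∈p) (x∈⁅x⁆ x)

extend-to-size : ∀ {n} t {W U : Subset n} → W ⊆ U → ∣ W ∣ ≤ t → t ≤ ∣ U ∣ →
                 ∃[ W′ ] (W ⊆ W′ × W′ ⊆ U × ∣ W′ ∣ ≡ t)
extend-to-size t {[]} {[]} _ _ t≤0 = [] , ⊆-refl , ⊆-refl , ≡.sym (ℕₚ.n≤0⇒n≡0 t≤0)
extend-to-size zero {true ∷ W} _ () _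
extend-to-size (suc t) {true ∷ W} {true ∷ U} W⊆U (s≤s W≤t) (s≤s t≤U)
  with extend-to-size t (drop-∷-⊆ W⊆U) W≤t t≤U
... | W′ , W⊆W′ , W′⊆U , ∣W′∣≡t = true ∷ W′ , s⊆s W⊆W′ , s⊆s W′⊆U , cong suc ∣W′∣≡t
extend-to-size t {true ∷ W} {false ∷ U} W⊆U with W⊆U here
... | ()
extend-to-size t {false ∷ W} {false ∷ U} W⊆U W≤t t≤U with extend-to-size t (drop-∷-⊆ W⊆U) W≤t t≤U
... | W′ , W⊆W′ , W′⊆U , ∣W′∣≡t = false ∷ W′ , s⊆s W⊆W′ , s⊆s W′⊆U , ∣W′∣≡t
extend-to-size t {false ∷ W} {true ∷ U} W⊆U W≤t t≤U with t ℕₚ.≤? ∣ U ∣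
... | no t≰U = true ∷ U , W⊆U , ⊆-refl , ℕₚ.≤-antisym (ℕₚ.≰⇒> t≰U) t≤U
... | yes t≤U′ with extend-to-size t (drop-∷-⊆ W⊆U) W≤t t≤U′
...   | W′ , W⊆W′ , W′⊆U , ∣W′∣≡t = false ∷ W′ , s⊆s W⊆W′ , out⊆ W′⊆U , ∣W′∣≡t

-- Walks and distances

module _ {n : ℕ} {A : Fin n → Fin n → Bool} where

  walk-head : ∀ {S u v ℓ} → WalkIn A S u v ℓ → S u
  walk-head (here Su) = Su
  walk-head (step Su _ _) = Su

  walk-last : ∀ {S u v ℓ} → WalkIn A S u v ℓ → S v
  walk-last (here Sv) = Sv
  walk-last (step _ _ w) = walk-last w

  walk-snoc : ∀ {S u v w ℓ} → WalkIn A S u v ℓ → A v w ≡ true → S w → WalkIn A S u w (suc ℓ)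
  walk-snoc (here Su) e Sw = step Su e (here Sw)
  walk-snoc (step Su e′ p) e Sw = step Su e′ (walk-snoc p e Sw)

  walk-++ : ∀ {S u v w ℓ ℓ′} → WalkIn A S u v ℓ → WalkIn A S v w ℓ′ → WalkIn A S u w (ℓ + ℓ′)
  walk-++ (here _) q = q
  walk-++ (step Su e p) q = step Su e (walk-++ p q)

  walk-reverse : (∀ u v → A u v ≡ A v u) → ∀ {S u v ℓ} → WalkIn A S u v ℓ → WalkIn A S v u ℓ
  walk-reverse A-sym (here Su) = here Su
  walk-reverse A-sym (step Su e p) = walk-snoc (walk-reverse A-sym p) (trans (A-sym _ _) e) Su

  walk-weaken : ∀ {S S′ : Fin n → Set} → (∀ {x} → S x → S′ x) →
                ∀ {u v ℓ} → WalkIn A S u v ℓ → WalkIn A S′ u v ℓ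
  walk-weaken S⇒S′ (here Su) = here (S⇒S′ Su)
  walk-weaken S⇒S′ (step Su e p) = step (S⇒S′ Su) e (walk-weaken S⇒S′ p)

  walk-closed : ∀ {P Q : Subset n} → (∀ {u v} → u ∈ Q → v ∈ P → A u v ≡ true → v ∈ Q) →
                ∀ {u v ℓ} → WalkIn A (_∈ P) u v ℓ → u ∈ Q → WalkIn A (_∈ Q) u v ℓ
  walk-closed closed (here _) u∈Q = here u∈Q
  walk-closed closed (step _ e p) u∈Q = step u∈Q e (walk-closed closed p (closed u∈Q (walk-head p) e))

walk-map : ∀ {n n′} {A : Fin n → Fin n → Bool} {A′ : Fin n′ → Fin n′ → Bool}
           {S : Fin n → Set} {S′ : Fin n′ → Set} (f : Fin n → Fin n′) →
           (∀ a b → A a b ≡ true → A′ (f a) (f b) ≡ true) → (∀ {a} → S a → S′ (f a)) →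
           ∀ {u v ℓ} → WalkIn A S u v ℓ → WalkIn A′ S′ (f u) (f v) ℓ
walk-map f f-adj f-S (here Su) = here (f-S Su)
walk-map f f-adj f-S (step Su e p) = step (f-S Su) (f-adj _ _ e) (walk-map f f-adj f-S p)

module _ (G : Graph) where

  private
    Walk : Fin (n G) → Fin (n G) → ℕ → Set
    Walk = WalkIn (adj G) (λ _ → Unit)

  walk? : ∀ ℓ u v → Dec (Walk u v ℓ)
  walk? zero u v = map′ (λ { refl → here tt }) (λ { (here _) → refl }) (u Fin.≟ v)
  walk? (suc ℓ) u v =
    map′ (λ { (w , e , p) → step tt e p }) (λ { (step _ e p) → _ , e , p })
         (Finₚ.any? (λ w → (adj G u w Bool.≟ true) ×-dec walk? ℓ w v))

  DistLe? : ∀ u v d → Dec (DistLe G u v d)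
  DistLe? u v d = map′ (λ { (ℓ , ℓ<1+d , p) → ℓ , ℕₚ.≤-pred ℓ<1+d , p })
                       (λ { (ℓ , ℓ≤d , p) → ℓ , s≤s ℓ≤d , p })
                       (ℕₚ.anyUpTo? (λ ℓ → walk? ℓ u v) (suc d))

  DistLe-refl : ∀ u → DistLe G u u 0
  DistLe-refl u = 0 , z≤n , here tt

  DistLe-sym : ∀ {u v d} → DistLe G u v d → DistLe G v u d
  DistLe-sym (ℓ , ℓ≤d , p) = ℓ , ℓ≤d , walk-reverse (Graph.sym G) p

  DistLe-trans : ∀ {u v w d d′} → DistLe G u v d → DistLe G v w d′ → DistLe G u w (d + d′)
  DistLe-trans (ℓ , ℓ≤d , p) (ℓ′ , ℓ′≤d′ , p′) = ℓ + ℓ′ , ℕₚ.+-mono-≤ ℓ≤d ℓ′≤d′ , walk-++ p p′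

  DistLe-mono : ∀ {u v d d′} → d ≤ d′ → DistLe G u v d → DistLe G u v d′
  DistLe-mono d≤d′ (ℓ , ℓ≤d , p) = ℓ , ℕₚ.≤-trans ℓ≤d d≤d′ , p

  walk⇒DistLe-along : ∀ {u v ℓ} → Walk u v ℓ → WalkIn (adj G) (λ y → DistLe G u y ℓ) u v ℓ
  walk⇒DistLe-along (here _) = here (DistLe-refl _)
  walk⇒DistLe-along (step _ e p) =
    step (DistLe-mono z≤n (DistLe-refl _)) e
         (walk-weaken (DistLe-trans (1 , ℕₚ.≤-refl , step tt e (here tt))) (walk⇒DistLe-along p))

-- Connected components

inflationary-fixpoint : ∀ {n} (F : Subset n → Subset n) (Inv : Subset n → Set) →
  (∀ R → R ⊆ F R) → (∀ R → Inv R → Inv (F R)) →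
  ∀ R → Inv R → ∃[ C ] (Inv C × F C ⊆ C)
inflationary-fixpoint {n} F Inv inflate preserve R inv =
  go (suc n) R (ℕₚ.m≤n+m (suc n) ∣ R ∣) inv
  where
  go : (fuel : ℕ) (R : Subset n) → n < ∣ R ∣ + fuel → Inv R → ∃[ C ] (Inv C × F C ⊆ C)
  go zero R n<∣R∣ _ =
    ⊥-elim (ℕₚ.<⇒≱ n<∣R∣ (ℕₚ.≤-trans (ℕₚ.≤-reflexive (ℕₚ.+-identityʳ _)) (∣p∣≤n R)))
  go (suc fuel) R n<∣R∣+1+fuel inv with R ⊂? F R
  ... | no R⊄FR = R , inv , λ {x} x∈FR →
    decidable-stable (x ∈? R) (λ x∉R → R⊄FR (inflate R , x , x∈FR , x∉R))
  ... | yes R⊂FR = go fuel (F R) n<∣FR∣+fuel (preserve R inv)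
    where
    n<∣FR∣+fuel : n < ∣ F R ∣ + fuel
    n<∣FR∣+fuel = ℕₚ.≤-trans n<∣R∣+1+fuel
      (ℕₚ.≤-trans (ℕₚ.≤-reflexive (ℕₚ.+-suc ∣ R ∣ fuel)) (ℕₚ.+-monoˡ-≤ fuel (p⊂q⇒∣p∣<∣q∣ R⊂FR)))

record Component {n : ℕ} (A : Fin n → Fin n → Bool) (P : Subset n) (x : Fin n) (C : Subset n) : Set where
  field
    x∈C    : x ∈ C
    C⊆P    : C ⊆ P
    reach  : ∀ {v} → v ∈ C → ∃[ ℓ ] WalkIn A (_∈ C) x v ℓ
    closed : ∀ {u v} → u ∈ C → v ∈ P → A u v ≡ true → v ∈ C

module _ {n : ℕ} (A : Fin n → Fin n → Bool) (P : Subset n) {x : Fin n} (x∈P : x ∈ P) where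

  private
    Grown : Subset n → Fin n → Set
    Grown R v = v ∈ R ⊎ (v ∈ P × ∃[ u ] (u ∈ R × A u v ≡ true))

    grown? : ∀ R v → Dec (Grown R v)
    grown? R v = (v ∈? R) ⊎-dec ((v ∈? P) ×-dec Finₚ.any? (λ u → (u ∈? R) ×-dec (A u v Bool.≟ true)))

    grow : Subset n → Subset n
    grow R = subset (grown? R)

    R⊆grow : ∀ R → R ⊆ grow R
    R⊆grow R v∈R = ∈-subset⁺ (grown? R) (inj₁ v∈R)

    Reached : Subset n → Set
    Reached R = x ∈ R × R ⊆ P × (∀ {v} → v ∈ R → ∃[ ℓ ] WalkIn A (_∈ R) x v ℓ)

    grow-reached : ∀ R → Reached R → Reached (grow R)
    grow-reached R (x∈R , R⊆P , reach) = R⊆grow R x∈R , grow⊆P , reach′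
      where
      grow⊆P : grow R ⊆ P
      grow⊆P v∈ with ∈-subset⁻ (grown? R) v∈
      ... | inj₁ v∈R = R⊆P v∈R
      ... | inj₂ (v∈P , _) = v∈P
      reach′ : ∀ {v} → v ∈ grow R → ∃[ ℓ ] WalkIn A (_∈ grow R) x v ℓ
      reach′ v∈ with ∈-subset⁻ (grown? R) v∈
      ... | inj₁ v∈R = let ℓ , p = reach v∈R in ℓ , walk-weaken (R⊆grow R) p
      ... | inj₂ (_ , u , u∈R , e) = let ℓ , p = reach u∈R in
                                     suc ℓ , walk-snoc (walk-weaken (R⊆grow R) p) e v∈

    ⁅x⁆-reached : Reached ⁅ x ⁆
    ⁅x⁆-reached = x∈⁅x⁆ x , (λ y∈ → subst (_∈ P) (≡.sym (x∈⁅y⁆⇒x≡y x y∈)) x∈P)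
                , λ y∈ → 0 , subst (λ y → WalkIn A (_∈ ⁅ x ⁆) x y 0) (≡.sym (x∈⁅y⁆⇒x≡y x y∈)) (here (x∈⁅x⁆ x))

  component : ∃[ C ] Component A P x C
  component with inflationary-fixpoint grow Reached R⊆grow grow-reached ⁅ x ⁆ ⁅x⁆-reached
  ... | C , (x∈C , C⊆P , reach) , grow⊆C = C , record
    { x∈C = x∈C ; C⊆P = C⊆P ; reach = reach
    ; closed = λ u∈C v∈P e → grow⊆C (∈-subset⁺ (grown? C) (inj₂ (v∈P , _ , u∈C , e))) }

Component⇒IsComponentOf- : ∀ (G : Graph) {X x C} → Component (adj G) (∁ X) x C → IsComponentOf- G X C
Component⇒IsComponentOf- G {x = x} {C} piece =
  (x , x∈C) , (λ v v∈C → x∈∁p⇒x∉p (C⊆P v∈C)) , connected , (λ u v u∈C v∉X e → closed u∈C (x∉p⇒x∈∁p v∉X) e)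
  where
  open Component piece
  connected : ∀ u v → u ∈ C → v ∈ C → ∃[ ℓ ] WalkIn (adj G) (_∈ C) u v ℓ
  connected u v u∈C v∈C with reach u∈C | reach v∈C
  ... | ℓ₁ , p₁ | ℓ₂ , p₂ = ℓ₁ + ℓ₂ , walk-++ (walk-reverse (Graph.sym G) p₁) p₂

-- Trees given by parent pointers

ChildOf : ∀ {t} → (Fin t → Fin (suc t)) → Fin (suc t) → Fin (suc t) → Set
ChildOf parent a b = ∃[ i ] (a ≡ suc i × parent i ≡ b)

module _ {t : ℕ} (parent : Fin t → Fin (suc t)) where

  treeAdj-sym : ∀ a b → treeAdj parent a b ≡ treeAdj parent b a
  treeAdj-sym zero zero = refl
  treeAdj-sym zero (suc j) = Boolₚ.∨-comm false ⌊ parent j Fin.≟ zero ⌋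
  treeAdj-sym (suc i) zero = Boolₚ.∨-comm ⌊ parent i Fin.≟ zero ⌋ false
  treeAdj-sym (suc i) (suc j) = Boolₚ.∨-comm ⌊ parent i Fin.≟ suc j ⌋ ⌊ parent j Fin.≟ suc i ⌋

  treeAdj⁺ : ∀ {a b} → ChildOf parent a b → treeAdj parent a b ≡ true
  treeAdj⁺ {b = b} (i , refl , parent-i≡b) with parent i Fin.≟ b
  ... | yes _ = refl
  ... | no parent-i≢b = ⊥-elim (parent-i≢b parent-i≡b)

  treeAdj⁻ : ∀ a b → treeAdj parent a b ≡ true → ChildOf parent a b ⊎ ChildOf parent b a
  treeAdj⁻ zero (suc j) e with parent j Fin.≟ zero
  ... | yes parent-j≡a = inj₂ (j , refl , parent-j≡a)
  treeAdj⁻ (suc i) zero e with parent i Fin.≟ zero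
  ... | yes parent-i≡b = inj₁ (i , refl , parent-i≡b)
  treeAdj⁻ (suc i) (suc j) e with parent i Fin.≟ suc j
  ... | yes parent-i≡b = inj₁ (i , refl , parent-i≡b)
  ... | no _ with parent j Fin.≟ suc i
  ...   | yes parent-j≡a = inj₂ (j , refl , parent-j≡a)

treeAdj-map : ∀ {t t′} {p : Fin t → Fin (suc t)} {p′ : Fin t′ → Fin (suc t′)}
              (f : Fin (suc t) → Fin (suc t′)) →
              (∀ i → ChildOf p′ (f (suc i)) (f (p i))) →
              ∀ a b → treeAdj p a b ≡ true → treeAdj p′ (f a) (f b) ≡ true
treeAdj-map {p = p} {p′} f f-child a b e with treeAdj⁻ p a b e
... | inj₁ (i , refl , refl) = treeAdj⁺ p′ (f-child i)
... | inj₂ (i , refl , refl) = trans (treeAdj-sym p′ (f a) (f b)) (treeAdj⁺ p′ (f-child i))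

record BaggedTree (n : ℕ) : Set where
  field
    t        : ℕ
    parent   : Fin t → Fin (suc t)
    parent<  : ∀ i → toℕ (parent i) ≤ toℕ i
    bag      : Fin (suc t) → Subset n
    coherent : ∀ v a b → v ∈ bag a → v ∈ bag b →
               ∃[ ℓ ] WalkIn (treeAdj parent) (λ c → v ∈ bag c) a b ℓ

singleBag : ∀ {n} → Subset n → BaggedTree n
singleBag B = record
  { t = 0 ; parent = λ () ; parent< = λ () ; bag = λ _ → B
  ; coherent = λ { v zero zero v∈B _ → 0 , here v∈B } }

data ↑-View (m k : ℕ) : Fin (m + k) → Set where
  left  : ∀ i → ↑-View m k (i ↑ˡ k)
  right : ∀ j → ↑-View m k (m ↑ʳ j)

↑-view : ∀ m k i → ↑-View m k i
↑-view m k i with splitAt m i in eq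
... | inj₁ j = subst (↑-View m k) (Finₚ.splitAt⁻¹-↑ˡ eq) (left j)
... | inj₂ j = subst (↑-View m k) (Finₚ.splitAt⁻¹-↑ʳ eq) (right j)

-- The root of T₂ becomes a child of the root of T₁; the nodes of T₁ are numbered first.
module Graft {n : ℕ} (T₁ T₂ : BaggedTree n) where
  private
    module T₁ = BaggedTree T₁
    module T₂ = BaggedTree T₂

  t : ℕ
  t = T₁.t + suc T₂.t

  inj₁ᵀ : Fin (suc T₁.t) → Fin (suc t)
  inj₁ᵀ a = a ↑ˡ suc T₂.t

  inj₂ᵀ : Fin (suc T₂.t) → Fin (suc t)
  inj₂ᵀ b = suc T₁.t ↑ʳ b

  private
    parent₂ : Fin (suc T₂.t) → Fin (suc t)
    parent₂ zero = zero
    parent₂ (suc j) = inj₂ᵀ (T₂.parent j)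

  parent : Fin t → Fin (suc t)
  parent i = [ inj₁ᵀ ∘ T₁.parent , parent₂ ]′ (splitAt T₁.t i)

  parent-inj₁ : ∀ i → parent (i ↑ˡ suc T₂.t) ≡ inj₁ᵀ (T₁.parent i)
  parent-inj₁ i rewrite Finₚ.splitAt-↑ˡ T₁.t i (suc T₂.t) = refl

  parent-inj₂ : ∀ j → parent (T₁.t ↑ʳ j) ≡ parent₂ j
  parent-inj₂ j rewrite Finₚ.splitAt-↑ʳ T₁.t (suc T₂.t) j = refl

  parent< : ∀ i → toℕ (parent i) ≤ toℕ i
  parent< i with ↑-view T₁.t (suc T₂.t) i
  ... | left i′ rewrite parent-inj₁ i′ | Finₚ.toℕ-↑ˡ (T₁.parent i′) (suc T₂.t) | Finₚ.toℕ-↑ˡ i′ (suc T₂.t) =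
    T₁.parent< i′
  ... | right zero rewrite parent-inj₂ zero = z≤n
  ... | right (suc j)
    rewrite parent-inj₂ (suc j) | Finₚ.toℕ-↑ʳ (suc T₁.t) (T₂.parent j) | Finₚ.toℕ-↑ʳ T₁.t (suc j) =
    ℕₚ.≤-trans (s≤s (ℕₚ.+-monoʳ-≤ T₁.t (T₂.parent< j))) (ℕₚ.≤-reflexive (≡.sym (ℕₚ.+-suc T₁.t (toℕ j))))

  bag : Fin (suc t) → Subset n
  bag a = [ T₁.bag , T₂.bag ]′ (splitAt (suc T₁.t) a)

  bag-inj₁ : ∀ a → bag (inj₁ᵀ a) ≡ T₁.bag a
  bag-inj₁ a rewrite Finₚ.splitAt-↑ˡ (suc T₁.t) a (suc T₂.t) = refl

  bag-inj₂ : ∀ b → bag (inj₂ᵀ b) ≡ T₂.bag b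
  bag-inj₂ b rewrite Finₚ.splitAt-↑ʳ (suc T₁.t) (suc T₂.t) b = refl

  root-bag : bag zero ≡ T₁.bag zero
  root-bag = bag-inj₁ zero

  ∈-inj₁ : ∀ {v} a → v ∈ T₁.bag a → v ∈ bag (inj₁ᵀ a)
  ∈-inj₁ a = subst (_ ∈_) (≡.sym (bag-inj₁ a))

  ∈-inj₂ : ∀ {v} b → v ∈ T₂.bag b → v ∈ bag (inj₂ᵀ b)
  ∈-inj₂ b = subst (_ ∈_) (≡.sym (bag-inj₂ b))

  all-bags : (P : Subset n → Set) → (∀ a → P (T₁.bag a)) → (∀ b → P (T₂.bag b)) → ∀ a → P (bag a)
  all-bags P P₁ P₂ a with ↑-view (suc T₁.t) (suc T₂.t) a
  ... | left a₁ = subst P (≡.sym (bag-inj₁ a₁)) (P₁ a₁)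
  ... | right a₂ = subst P (≡.sym (bag-inj₂ a₂)) (P₂ a₂)

  private
    walk-inj₁ : ∀ v {a b ℓ} → WalkIn (treeAdj T₁.parent) (λ c → v ∈ T₁.bag c) a b ℓ →
                WalkIn (treeAdj parent) (λ c → v ∈ bag c) (inj₁ᵀ a) (inj₁ᵀ b) ℓ
    walk-inj₁ v = walk-map inj₁ᵀ
      (treeAdj-map {p = T₁.parent} {parent} inj₁ᵀ (λ i → i ↑ˡ suc T₂.t , refl , parent-inj₁ i)) (∈-inj₁ _)

    walk-inj₂ : ∀ v {a b ℓ} → WalkIn (treeAdj T₂.parent) (λ c → v ∈ T₂.bag c) a b ℓ →
                WalkIn (treeAdj parent) (λ c → v ∈ bag c) (inj₂ᵀ a) (inj₂ᵀ b) ℓ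
    walk-inj₂ v = walk-map inj₂ᵀ
      (treeAdj-map {p = T₂.parent} {parent} inj₂ᵀ (λ i → T₁.t ↑ʳ suc i , refl , parent-inj₂ (suc i))) (∈-inj₂ _)

    roots-adjacent : treeAdj parent zero (inj₂ᵀ zero) ≡ true
    roots-adjacent = trans (treeAdj-sym parent zero (inj₂ᵀ zero))
                           (treeAdj⁺ parent (T₁.t ↑ʳ zero , refl , parent-inj₂ zero))

  module _ (shared-in-roots : ∀ v a b → v ∈ T₁.bag a → v ∈ T₂.bag b → v ∈ T₁.bag zero × v ∈ T₂.bag zero) where

    private
      across : ∀ v a b → v ∈ T₁.bag a → v ∈ T₂.bag b →
               ∃[ ℓ ] WalkIn (treeAdj parent) (λ c → v ∈ bag c) (inj₁ᵀ a) (inj₂ᵀ b) ℓ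
      across v a b v∈a v∈b with shared-in-roots v a b v∈a v∈b
      ... | v∈root₁ , v∈root₂ with T₁.coherent v a zero v∈a v∈root₁ | T₂.coherent v zero b v∈root₂ v∈b
      ... | ℓ₁ , p₁ | ℓ₂ , p₂ = ℓ₁ + suc ℓ₂ , walk-++ (walk-inj₁ v p₁)
              (step (∈-inj₁ zero v∈root₁) roots-adjacent (walk-inj₂ v p₂))

      coherent : ∀ v a b → v ∈ bag a → v ∈ bag b → ∃[ ℓ ] WalkIn (treeAdj parent) (λ c → v ∈ bag c) a b ℓ
      coherent v a b v∈a v∈b with ↑-view (suc T₁.t) (suc T₂.t) a | ↑-view (suc T₁.t) (suc T₂.t) b
      ... | left a₁ | left b₁ =
        let ℓ , p = T₁.coherent v a₁ b₁ (subst (v ∈_) (bag-inj₁ a₁) v∈a) (subst (v ∈_) (bag-inj₁ b₁) v∈b)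
        in ℓ , walk-inj₁ v p
      ... | right a₂ | right b₂ =
        let ℓ , p = T₂.coherent v a₂ b₂ (subst (v ∈_) (bag-inj₂ a₂) v∈a) (subst (v ∈_) (bag-inj₂ b₂) v∈b)
        in ℓ , walk-inj₂ v p
      ... | left a₁ | right b₂ =
        across v a₁ b₂ (subst (v ∈_) (bag-inj₁ a₁) v∈a) (subst (v ∈_) (bag-inj₂ b₂) v∈b)
      ... | right a₂ | left b₁ =
        let ℓ , p = across v b₁ a₂ (subst (v ∈_) (bag-inj₁ b₁) v∈b) (subst (v ∈_) (bag-inj₂ a₂) v∈a)
        in ℓ , walk-reverse (treeAdj-sym parent) p

    graft : BaggedTree n
    graft = record { t = t ; parent = parent ; parent< = parent< ; bag = bag ; coherent = coherent }

-- Tree decompositions from balanced separators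

Balanced : ∀ {n} → (Fin n → Fin n → Bool) → Subset n → Subset n → Set
Balanced A P W = ∀ x C → (∀ v → v ∈ C → ∃[ ℓ ] WalkIn A (_∈ P) x v ℓ) → 2 * ∣ W ∩ C ∣ ≤ ∣ W ∣

Balanced-antitone : ∀ {n} {A : Fin n → Fin n → Bool} {P Q W : Subset n} →
                    P ⊆ Q → Balanced A Q W → Balanced A P W
Balanced-antitone P⊆Q balanced x C reach =
  balanced x C (λ v v∈C → let ℓ , p = reach v v∈C in ℓ , walk-weaken P⊆Q p)

2a≤1+2s⇒a≤s : ∀ a s → 2 * a ≤ suc (s + s) → a ≤ s
2a≤1+2s⇒a≤s a s 2a≤1+2s =
  ℕₚ.≤-pred (ℕₚ.*-cancelˡ-< 2 a (suc s) (ℕₚ.≤-trans (s≤s 2a≤1+2s) (ℕₚ.≤-reflexive (2+2s≡2[1+s] s))))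
  where
  2+2s≡2[1+s] : ∀ s → suc (suc (s + s)) ≡ 2 * suc s
  2+2s≡2[1+s] = solve-∀

module SeparatorsToTreeDecomposition
  {n : ℕ} (V : Subset n) (A : Fin n → Fin n → Bool) (A-sym : ∀ u v → A u v ≡ A v u)
  (E : Fin n → Fin n → Set) (E⇒A : ∀ {u v} → E u v → A u v ≡ true) (s : ℕ)
  (separator : ∀ W → ∃[ S ] (∣ S ∣ ≤ s × Balanced A (V ─ S) W)) where

  record RootedDecomposition (U W : Subset n) : Set where
    field
      tree : BaggedTree n
    open BaggedTree tree public
    field
      bag⊆U     : ∀ a → bag a ⊆ U
      W⊆root    : W ⊆ bag zero
      vertexCov : ∀ v → v ∈ U → ∃[ a ] v ∈ bag a
      edgeCov   : ∀ u v → u ∈ U → v ∈ U → u ≢ v → E u v → ∃[ a ] (u ∈ bag a × v ∈ bag a)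
      width≤    : ∀ a → ∣ bag a ∣ ≤ suc (3 * s)

  decompose-small : ∀ {U W} → ∣ U ∣ ≤ suc (3 * s) → W ⊆ U → RootedDecomposition U W
  decompose-small ∣U∣≤ W⊆U = record
    { tree = singleBag _ ; bag⊆U = λ _ → id ; W⊆root = W⊆U
    ; vertexCov = λ _ v∈U → zero , v∈U ; edgeCov = λ _ _ u∈U v∈U _ _ → zero , u∈U , v∈U
    ; width≤ = λ _ → ∣U∣≤ }

  module Split (U W W′ S : Subset n)
    (recurse : ∀ U₁ W₁ → U₁ ⊆ U → W₁ ⊆ U₁ → ∣ W₁ ∣ ≤ suc (s + s) → ∣ U₁ ∣ < ∣ U ∣ → RootedDecomposition U₁ W₁)
    (W⊆W′ : W ⊆ W′) (W′⊆U : W′ ⊆ U) (S⊆U : S ⊆ U)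
    (∣W′∣≡1+2s : ∣ W′ ∣ ≡ suc (s + s)) (∣S∣≤s : ∣ S ∣ ≤ s) (balanced : Balanced A (U ─ S) W′) where

    B : Subset n
    B = W′ ∪ S

    ∣B∣≤1+3s : ∣ B ∣ ≤ suc (3 * s)
    ∣B∣≤1+3s = ℕₚ.≤-trans (∣p∪q∣≤∣p∣+∣q∣ W′ S)
                 (ℕₚ.≤-trans (ℕₚ.+-mono-≤ (ℕₚ.≤-reflexive ∣W′∣≡1+2s) ∣S∣≤s) (ℕₚ.≤-reflexive (1+2s+s≡1+3s s)))
      where
      1+2s+s≡1+3s : ∀ s → suc (s + s) + s ≡ suc (3 * s)
      1+2s+s≡1+3s = solve-∀

    ∣W′∩C∣+∣S∣≤2s : ∀ C → ∣ W′ ∩ C ∣ ≤ s → ∣ W′ ∩ C ∣ + ∣ S ∣ ≤ s + s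
    ∣W′∩C∣+∣S∣≤2s C ∣W′∩C∣≤s = ℕₚ.+-mono-≤ ∣W′∩C∣≤s ∣S∣≤s

    -- Otherwise W′ ⊆ (W′ ∩ C) ∪ S, which has at most 2s < ∣ W′ ∣ elements.
    piece-smaller : ∀ C → C ⊆ U → ∣ W′ ∩ C ∣ ≤ s → ∣ C ∪ S ∣ < ∣ U ∣
    piece-smaller C C⊆U ∣W′∩C∣≤s with (C ∪ S) ⊂? U
    ... | yes C∪S⊂U = p⊂q⇒∣p∣<∣q∣ C∪S⊂U
    ... | no C∪S⊄U = ⊥-elim (ℕₚ.<⇒≱ (s≤s (∣W′∩C∣+∣S∣≤2s C ∣W′∩C∣≤s))
                       (ℕₚ.≤-trans (ℕₚ.≤-reflexive (≡.sym ∣W′∣≡1+2s)) (p⊆q∪r⇒∣p∣≤∣q∣+∣r∣ (W′ ∩ C) S W′⊆)))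
      where
      W′⊆ : W′ ⊆ (W′ ∩ C) ∪ S
      W′⊆ {y} y∈W′ = decidable-stable (y ∈? (W′ ∩ C) ∪ S) λ y∉ →
        C∪S⊄U (∪-lub C⊆U S⊆U , y , W′⊆U y∈W′ ,
               λ y∈C∪S → y∉ (x∈p∪r⇒x∈q∪r⇒x∈p∩q∪r (p⊆p∪q S y∈W′) y∈C∪S))

    -- A decomposition with root bag B of everything but the pieces inside rem, which are still to be hung.
    record Partial (rem : Subset n) : Set where
      field
        tree : BaggedTree n
      open BaggedTree tree public
      field
        rem⊆U─S     : rem ⊆ U ─ S
        rem-closed  : ∀ {u v} → u ∈ rem → v ∈ U ─ S → A u v ≡ true → v ∈ rem
        root≡B      : bag zero ≡ B
        bag⊆U       : ∀ a → bag a ⊆ U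
        bag⊆B∪done  : ∀ a {v} → v ∈ bag a → v ∈ B ⊎ v ∉ rem
        vertexCov   : ∀ v → v ∈ U → v ∈ rem ⊎ ∃[ a ] v ∈ bag a
        edgeCov     : ∀ u v → u ∈ U → v ∈ U → u ≢ v → E u v →
                      (u ∈ rem ⊎ v ∈ rem) ⊎ ∃[ a ] (u ∈ bag a × v ∈ bag a)
        width≤      : ∀ a → ∣ bag a ∣ ≤ suc (3 * s)

    start : Partial (U ─ S)
    start = record
      { tree = singleBag B ; rem⊆U─S = id ; rem-closed = λ _ v∈ _ → v∈
      ; root≡B = refl ; bag⊆U = λ _ → ∪-lub W′⊆U S⊆U ; bag⊆B∪done = λ _ → inj₁
      ; vertexCov = vertexCov ; edgeCov = edgeCov ; width≤ = λ _ → ∣B∣≤1+3s }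
      where
      vertexCov : ∀ v → v ∈ U → v ∈ U ─ S ⊎ ∃[ a ] v ∈ B
      vertexCov v v∈U with v ∈? S
      ... | yes v∈S = inj₂ (zero , q⊆p∪q W′ S v∈S)
      ... | no v∉S = inj₁ (x∈p∧x∉q⇒x∈p─q v∈U v∉S)
      edgeCov : ∀ u v → u ∈ U → v ∈ U → u ≢ v → E u v → (u ∈ U ─ S ⊎ v ∈ U ─ S) ⊎ ∃[ a ] (u ∈ B × v ∈ B)
      edgeCov u v u∈U v∈U _ _ with u ∈? S | v ∈? S
      ... | no u∉S | _ = inj₁ (inj₁ (x∈p∧x∉q⇒x∈p─q u∈U u∉S))
      ... | yes _ | no v∉S = inj₁ (inj₂ (x∈p∧x∉q⇒x∈p─q v∈U v∉S))
      ... | yes u∈S | yes v∈S = inj₂ (zero , q⊆p∪q W′ S u∈S , q⊆p∪q W′ S v∈S)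

    finish : ∀ {rem} → Empty rem → Partial rem → RootedDecomposition U W
    finish rem-empty partial = record
      { tree = tree ; bag⊆U = bag⊆U
      ; W⊆root = λ v∈W → subst (_ ∈_) (≡.sym root≡B) (p⊆p∪q S (W⊆W′ v∈W))
      ; vertexCov = λ v v∈U → [ (λ v∈rem → ⊥-elim (rem-empty (v , v∈rem))) , id ]′ (vertexCov v v∈U)
      ; edgeCov = λ u v u∈U v∈U u≢v e → [ [ (λ u∈rem → ⊥-elim (rem-empty (u , u∈rem)))
                                           , (λ v∈rem → ⊥-elim (rem-empty (v , v∈rem))) ]′ , id ]′
                                         (edgeCov u v u∈U v∈U u≢v e)
      ; width≤ = width≤ }
      where open Partial partial

    -- The piece C is hung below the root B via a decomposition of C ∪ S whose root contains (W′ ∩ C) ∪ S.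
    module Hang {rem : Subset n} (partial : Partial rem) {x : Fin n} (x∈rem : x ∈ rem)
                {C : Subset n} (piece : Component A (U ─ S) x C) where
      private
        open Partial partial
        module piece = Component piece

        C⊆rem : C ⊆ rem
        C⊆rem v∈C = let _ , p = piece.reach v∈C in
                    walk-last (walk-closed rem-closed (walk-weaken piece.C⊆P p) x∈rem)

        C⊆U : C ⊆ U
        C⊆U = p─q⊆p U S ∘ piece.C⊆P

        C∪S⊆U : C ∪ S ⊆ U
        C∪S⊆U = ∪-lub C⊆U S⊆U

        ∣W′∩C∣≤s : ∣ W′ ∩ C ∣ ≤ s
        ∣W′∩C∣≤s = 2a≤1+2s⇒a≤s _ s (subst (2 * ∣ W′ ∩ C ∣ ≤_) ∣W′∣≡1+2s
                     (balanced x C (λ v v∈C → let ℓ , p = piece.reach v∈C in ℓ , walk-weaken piece.C⊆P p)))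

        neighbour∈C∪S : ∀ {u v} → u ∈ C → v ∈ U → A u v ≡ true → v ∈ C ∪ S
        neighbour∈C∪S {v = v} u∈C v∈U e with v ∈? S
        ... | yes v∈S = q⊆p∪q C S v∈S
        ... | no v∉S = p⊆p∪q S (piece.closed u∈C (x∈p∧x∉q⇒x∈p─q v∈U v∉S) e)

        child : RootedDecomposition (C ∪ S) ((W′ ∩ C) ∪ S)
        child = recurse (C ∪ S) ((W′ ∩ C) ∪ S) C∪S⊆U
                  (∪-lub (p⊆p∪q S ∘ p∩q⊆q W′ C) (q⊆p∪q C S))
                  (ℕₚ.≤-trans (∣p∪q∣≤∣p∣+∣q∣ (W′ ∩ C) S) (ℕₚ.m≤n⇒m≤1+n (∣W′∩C∣+∣S∣≤2s C ∣W′∩C∣≤s)))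
                  (piece-smaller C C⊆U ∣W′∩C∣≤s)
        module D = RootedDecomposition child

        shared-in-roots : ∀ v a b → v ∈ bag a → v ∈ D.bag b → v ∈ bag zero × v ∈ D.bag zero
        shared-in-roots v a b v∈a v∈b =
          subst (v ∈_) (≡.sym root≡B) v∈B , D.W⊆root (x∈p∪r⇒x∈q∪r⇒x∈p∩q∪r v∈B (D.bag⊆U b v∈b))
          where
          v∈B : v ∈ B
          v∈B with bag⊆B∪done a v∈a
          ... | inj₁ v∈B = v∈B
          ... | inj₂ v∉rem with x∈p∪q⁻ C S (D.bag⊆U b v∈b)
          ...   | inj₁ v∈C = ⊥-elim (v∉rem (C⊆rem v∈C))
          ...   | inj₂ v∈S = q⊆p∪q W′ S v∈S

        module G = Graft tree D.tree

        ∉rem⊎∈C⇒∉rem─C : ∀ {v} → v ∉ rem ⊎ v ∈ C → v ∉ rem ─ C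
        ∉rem⊎∈C⇒∉rem─C (inj₁ v∉rem) = v∉rem ∘ p─q⊆p rem C
        ∉rem⊎∈C⇒∉rem─C {v} (inj₂ v∈C) v∈rem─C = x∈p─q⇒x∉q rem C v∈rem─C v∈C

        rem─C-closed : ∀ {u v} → u ∈ rem ─ C → v ∈ U ─ S → A u v ≡ true → v ∈ rem ─ C
        rem─C-closed u∈rem─C v∈U─S e = x∈p∧x∉q⇒x∈p─q (rem-closed (p─q⊆p rem C u∈rem─C) v∈U─S e)
          λ v∈C → x∈p─q⇒x∉q rem C u∈rem─C
                    (piece.closed v∈C (rem⊆U─S (p─q⊆p rem C u∈rem─C)) (trans (A-sym _ _) e))

        bag⊆B∪done′ : ∀ a {v} → v ∈ G.bag a → v ∈ B ⊎ v ∉ rem ─ C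
        bag⊆B∪done′ = G.all-bags (λ X → ∀ {v} → v ∈ X → v ∈ B ⊎ v ∉ rem ─ C)
          (λ a v∈a → Sum.map₂ (∉rem⊎∈C⇒∉rem─C ∘ inj₁) (bag⊆B∪done a v∈a))
          (λ b v∈b → Sum.map (q⊆p∪q W′ S) (∉rem⊎∈C⇒∉rem─C ∘ inj₂) (Sum.swap (x∈p∪q⁻ C S (D.bag⊆U b v∈b))))

        vertexCov′ : ∀ v → v ∈ U → v ∈ rem ─ C ⊎ ∃[ a ] v ∈ G.bag a
        vertexCov′ v v∈U with vertexCov v v∈U
        ... | inj₂ (a , v∈a) = inj₂ (G.inj₁ᵀ a , G.∈-inj₁ a v∈a)
        ... | inj₁ v∈rem with v ∈? C
        ...   | no v∉C = inj₁ (x∈p∧x∉q⇒x∈p─q v∈rem v∉C)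
        ...   | yes v∈C = let b , v∈b = D.vertexCov v (p⊆p∪q S v∈C) in inj₂ (G.inj₂ᵀ b , G.∈-inj₂ b v∈b)

        edge-in-child : ∀ u v → u ∈ C ∪ S → v ∈ C ∪ S → u ≢ v → E u v → ∃[ a ] (u ∈ G.bag a × v ∈ G.bag a)
        edge-in-child u v u∈ v∈ u≢v e = let b , u∈b , v∈b = D.edgeCov u v u∈ v∈ u≢v e in
                                        G.inj₂ᵀ b , G.∈-inj₂ b u∈b , G.∈-inj₂ b v∈b

        edgeCov′ : ∀ u v → u ∈ U → v ∈ U → u ≢ v → E u v →
                   (u ∈ rem ─ C ⊎ v ∈ rem ─ C) ⊎ ∃[ a ] (u ∈ G.bag a × v ∈ G.bag a)
        edgeCov′ u v u∈U v∈U u≢v e with edgeCov u v u∈U v∈U u≢v e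
        ... | inj₂ (a , u∈a , v∈a) = inj₂ (G.inj₁ᵀ a , G.∈-inj₁ a u∈a , G.∈-inj₁ a v∈a)
        ... | inj₁ (inj₁ u∈rem) with u ∈? C
        ...   | no u∉C = inj₁ (inj₁ (x∈p∧x∉q⇒x∈p─q u∈rem u∉C))
        ...   | yes u∈C = inj₂ (edge-in-child u v (p⊆p∪q S u∈C) (neighbour∈C∪S u∈C v∈U (E⇒A e)) u≢v e)
        edgeCov′ u v u∈U v∈U u≢v e | inj₁ (inj₂ v∈rem) with v ∈? C
        ...   | no v∉C = inj₁ (inj₂ (x∈p∧x∉q⇒x∈p─q v∈rem v∉C))
        ...   | yes v∈C = inj₂ (edge-in-child u v (neighbour∈C∪S v∈C u∈U (trans (A-sym _ _) (E⇒A e)))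
                                                  (p⊆p∪q S v∈C) u≢v e)

      partial′ : Partial (rem ─ C)
      partial′ = record
        { tree = G.graft shared-in-roots
        ; rem⊆U─S = rem⊆U─S ∘ p─q⊆p rem C
        ; rem-closed = rem─C-closed
        ; root≡B = trans G.root-bag root≡B
        ; bag⊆U = G.all-bags (_⊆ U) bag⊆U (λ b → C∪S⊆U ∘ D.bag⊆U b)
        ; bag⊆B∪done = bag⊆B∪done′
        ; vertexCov = vertexCov′
        ; edgeCov = edgeCov′
        ; width≤ = G.all-bags (λ X → ∣ X ∣ ≤ suc (3 * s)) width≤ D.width≤ }

    exhaust : (fuel : ℕ) → ∀ {rem} → ∣ rem ∣ < fuel → Partial rem → RootedDecomposition U W
    exhaust zero () _
    exhaust (suc fuel) {rem} ∣rem∣<1+fuel partial with nonempty? rem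
    ... | no rem-empty = finish rem-empty partial
    ... | yes (x , x∈rem) with component A (U ─ S) (Partial.rem⊆U─S partial x∈rem)
    ...   | C , piece = exhaust fuel
            (ℕₚ.≤-trans (p∩q≢∅⇒∣p─q∣<∣p∣ rem C (x , x∈p∩q⁺ (x∈rem , Component.x∈C piece)))
                        (ℕₚ.≤-pred ∣rem∣<1+fuel))
            (Hang.partial′ partial x∈rem piece)

    decomposition : RootedDecomposition U W
    decomposition = exhaust (suc ∣ U ─ S ∣) ℕₚ.≤-refl start

  decompose : (fuel : ℕ) → ∀ U W → ∣ U ∣ < fuel → U ⊆ V → W ⊆ U → ∣ W ∣ ≤ suc (s + s) →
              RootedDecomposition U W
  decompose zero _ _ () _ _ _
  decompose (suc fuel) U W ∣U∣<1+fuel U⊆V W⊆U ∣W∣≤1+2s with ∣ U ∣ ℕₚ.≤? suc (3 * s)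
  ... | yes ∣U∣≤1+3s = decompose-small ∣U∣≤1+3s W⊆U
  ... | no ∣U∣≰1+3s with extend-to-size (suc (s + s)) W⊆U ∣W∣≤1+2s 1+2s≤∣U∣
    where
    1+2s≤∣U∣ : suc (s + s) ≤ ∣ U ∣
    1+2s≤∣U∣ = ℕₚ.≤-trans (s≤s (ℕₚ.+-monoʳ-≤ s (ℕₚ.m≤m+n s (s + 0)))) (ℕₚ.<⇒≤ (ℕₚ.≰⇒> ∣U∣≰1+3s))
  ... | W′ , W⊆W′ , W′⊆U , ∣W′∣≡1+2s with separator W′
  ... | S , ∣S∣≤s , balanced =
    Split.decomposition U W W′ (S ∩ U) recurse W⊆W′ W′⊆U (p∩q⊆q S U) ∣W′∣≡1+2s
      (ℕₚ.≤-trans (∣p∩q∣≤∣p∣ S U) ∣S∣≤s) (Balanced-antitone {W = W′} U─S⊆V─S balanced)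
    where
    recurse : ∀ U₁ W₁ → U₁ ⊆ U → W₁ ⊆ U₁ → ∣ W₁ ∣ ≤ suc (s + s) → ∣ U₁ ∣ < ∣ U ∣ → RootedDecomposition U₁ W₁
    recurse U₁ W₁ U₁⊆U W₁⊆U₁ ∣W₁∣≤1+2s ∣U₁∣<∣U∣ =
      decompose fuel U₁ W₁ (ℕₚ.≤-trans ∣U₁∣<∣U∣ (ℕₚ.≤-pred ∣U∣<1+fuel)) (U⊆V ∘ U₁⊆U) W₁⊆U₁ ∣W₁∣≤1+2s
    U─S⊆V─S : U ─ (S ∩ U) ⊆ V ─ S
    U─S⊆V─S x∈ = x∈p∧x∉q⇒x∈p─q (U⊆V (p─q⊆p U (S ∩ U) x∈))
                   λ x∈S → x∈p─q⇒x∉q U (S ∩ U) x∈ (x∈p∩q⁺ (x∈S , p─q⊆p U (S ∩ U) x∈))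

  treeDecomposition : TreeDecomposition V E (3 * s)
  treeDecomposition = record
    { t = t ; parent = parent ; parent< = parent< ; bag = bag ; bag⊆V = bag⊆U
    ; vertexCov = vertexCov ; edgeCov = edgeCov ; coherent = coherent ; width≤ = width≤ }
    where
    open RootedDecomposition
      (decompose (suc ∣ V ∣) V ⊥ ℕₚ.≤-refl id ⊥⊆ (ℕₚ.≤-trans (ℕₚ.≤-reflexive (∣⊥∣≡0 n)) z≤n))

-- Balanced separators of the distance graph

indicator : ∀ {n} → Subset n → Fin n → ℚ
indicator W v = if lookup W v then 1ℚ else 0ℚ

indicator-nonneg : ∀ {n} (W : Subset n) v → 0ℚ ℚ.≤ indicator W v
indicator-nonneg W v with lookup W v
... | true = ℚₚ.nonNegative⁻¹ _
... | false = ℚₚ.≤-refl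

ℕ→ℚᵘ : ℕ → ℚᵘ
ℕ→ℚᵘ a = mkℚᵘ (ℤ.+ a) 0

ℕ→ℚᵘ-+ : ∀ a b → ℕ→ℚᵘ a ℚᵘ.+ ℕ→ℚᵘ b ≃ ℕ→ℚᵘ (a + b)
ℕ→ℚᵘ-+ a b = ℚᵘ.*≡* (begin
  (ℤ.+ a ℤ.* ℤ.+ 1 ℤ.+ ℤ.+ b ℤ.* ℤ.+ 1) ℤ.* ℤ.+ 1 ≡⟨ ℤₚ.*-identityʳ _ ⟩
  ℤ.+ a ℤ.* ℤ.+ 1 ℤ.+ ℤ.+ b ℤ.* ℤ.+ 1            ≡⟨ cong₂ ℤ._+_ (ℤₚ.*-identityʳ (ℤ.+ a))
                                                                  (ℤₚ.*-identityʳ (ℤ.+ b)) ⟩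
  ℤ.+ a ℤ.+ ℤ.+ b                                 ≡⟨ ≡.sym (ℤₚ.pos-+ a b) ⟩
  ℤ.+ (a + b)                                     ≡⟨ ≡.sym (ℤₚ.*-identityʳ _) ⟩
  ℤ.+ (a + b) ℤ.* ℤ.+ 1                           ∎)
  where open ≡-Reasoning

sumOver-indicator : ∀ {n} (W D : Subset n) → ℚ.toℚᵘ (sumOver (indicator W) D) ≃ ℕ→ℚᵘ ∣ W ∩ D ∣
sumOver-indicator [] [] = ℚᵘₚ.≃-refl
sumOver-indicator (true ∷ W) (true ∷ D) = ℚᵘₚ.≃-trans (ℚₚ.toℚᵘ-homo-+ 1ℚ (sumOver (indicator W) D))
  (ℚᵘₚ.≃-trans (ℚᵘₚ.+-congʳ (ℕ→ℚᵘ 1) (sumOver-indicator W D)) (ℕ→ℚᵘ-+ 1 _))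
sumOver-indicator (false ∷ W) (true ∷ D) = ℚᵘₚ.≃-trans (ℚₚ.toℚᵘ-homo-+ 0ℚ (sumOver (indicator W) D))
  (ℚᵘₚ.≃-trans (ℚᵘₚ.+-congʳ (ℕ→ℚᵘ 0) (sumOver-indicator W D)) (ℕ→ℚᵘ-+ 0 _))
sumOver-indicator (true ∷ W) (false ∷ D) = sumOver-indicator W D
sumOver-indicator (false ∷ W) (false ∷ D) = sumOver-indicator W D

indicator-half : ∀ {n} (W D : Subset n) →
                 sumOver (indicator W) D ℚ.≤ ½ ℚ.* sumOver (indicator W) ⊤ → 2 * ∣ W ∩ D ∣ ≤ ∣ W ∣
indicator-half W D half with ℚᵘₚ.≤-respʳ-≃ ½W≃ (ℚᵘₚ.≤-respˡ-≃ (sumOver-indicator W D) (ℚₚ.toℚᵘ-mono-≤ half))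
  where
  ½W≃ : ℚ.toℚᵘ (½ ℚ.* sumOver (indicator W) ⊤) ≃ ℚ.toℚᵘ ½ ℚᵘ.* ℕ→ℚᵘ ∣ W ∩ ⊤ ∣
  ½W≃ = ℚᵘₚ.≃-trans (ℚₚ.toℚᵘ-homo-* ½ (sumOver (indicator W) ⊤)) (ℚᵘₚ.*-congˡ (sumOver-indicator W ⊤))
... | ℚᵘ.*≤* WD*2≤W =
  subst₂ _≤_ (ℕₚ.*-comm ∣ W ∩ D ∣ 2) (cong ∣_∣ (∩-identityʳ W))
    (ℤₚ.drop‿+≤+ (subst₂ ℤ._≤_ (≡.sym (ℤₚ.pos-* ∣ W ∩ D ∣ 2))
                                (trans (ℤₚ.*-identityʳ _) (ℤₚ.*-identityˡ _)) WD*2≤W))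

∣X∣≤length-centres : ∀ {n} (R : Fin n → Fin n → Set) (R? : ∀ c v → Dec (R c v))
                     (cs : List (Fin n)) (X : Subset n) →
                     (∀ v → v ∈ X → ∃[ c ] (c ∈ₗ cs × R c v)) →
                     (∀ c {u v} → R c u → R c v → u ∈ X → v ∈ X → u ≡ v) →
                     ∣ X ∣ ≤ length cs
∣X∣≤length-centres {n} R R? [] X covered unique =
  ℕₚ.≤-trans (p⊆q⇒∣p∣≤∣q∣ X⊆⊥) (ℕₚ.≤-reflexive (∣⊥∣≡0 n))
  where
  X⊆⊥ : X ⊆ ⊥
  X⊆⊥ {v} v∈X with covered v v∈X
  ... | _ , () , _
∣X∣≤length-centres R R? (c ∷ cs) X covered unique =
  ℕₚ.≤-trans (p⊆q∪r⇒∣p∣≤∣q∣+∣r∣ (X ∩ Rc) (X ─ Rc) (p⊆p∩q∪p─q X Rc))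
    (ℕₚ.+-mono-≤ (all-equal⇒∣p∣≤1 (X ∩ Rc) near-c-equal)
                 (∣X∣≤length-centres R R? cs (X ─ Rc) covered′
                    λ c′ Ru Rv u∈ v∈ → unique c′ Ru Rv (p─q⊆p X Rc u∈) (p─q⊆p X Rc v∈)))
  where
  Rc = subset (R? c)
  near-c-equal : ∀ {u v} → u ∈ X ∩ Rc → v ∈ X ∩ Rc → u ≡ v
  near-c-equal u∈ v∈ = unique c (∈-subset⁻ (R? c) (p∩q⊆q X Rc u∈)) (∈-subset⁻ (R? c) (p∩q⊆q X Rc v∈))
                         (p∩q⊆p X Rc u∈) (p∩q⊆p X Rc v∈)
  covered′ : ∀ v → v ∈ X ─ Rc → ∃[ c′ ] (c′ ∈ₗ cs × R c′ v)
  covered′ v v∈ with covered v (p─q⊆p X Rc v∈)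
  ... | _ , here refl , Rcv = ⊥-elim (x∈p─q⇒x∉q X Rc v∈ (∈-subset⁺ (R? c) Rcv))
  ... | c′ , there c′∈cs , Rc′v = c′ , c′∈cs , Rc′v

module _ (G : Graph) (m : ℕ) (doubling : DoublingDimAtMost G m) where

  refine : ∀ {X} cs d → CoveredBy G cs d X →
           ∃[ cs′ ] (length cs′ ≤ length cs * 2 ^ m × CoveredBy G cs′ ⌊ d /2⌋ X)
  refine {X} cs d covered = concatMap halves cs , length-bound cs , covered′
    where
    halves : Fin (n G) → List (Fin (n G))
    halves c = proj₁ (doubling c d)
    length-bound : ∀ cs → length (concatMap halves cs) ≤ length cs * 2 ^ m
    length-bound [] = z≤n
    length-bound (c ∷ cs) = ℕₚ.≤-trans (ℕₚ.≤-reflexive (Listₚ.length-++ (halves c)))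
                              (ℕₚ.+-mono-≤ (proj₁ (proj₂ (doubling c d))) (length-bound cs))
    covered′ : CoveredBy G (concatMap halves cs) ⌊ d /2⌋ X
    covered′ v v∈X with covered v v∈X
    ... | c , c∈cs , v∈ball with proj₂ (proj₂ (doubling c d)) v v∈ball
    ...   | c′ , c′∈halves , v∈ball′ = c′ , ∈-concatMap⁺ halves (lose c∈cs c′∈halves) , v∈ball′

⌊r/2⌋+⌊r/2⌋≤r : ∀ r → ⌊ r /2⌋ + ⌊ r /2⌋ ≤ r
⌊r/2⌋+⌊r/2⌋≤r r =
  ℕₚ.≤-trans (ℕₚ.+-monoʳ-≤ ⌊ r /2⌋ (ℕₚ.⌊n/2⌋≤⌈n/2⌉ r)) (ℕₚ.≤-reflexive (ℕₚ.⌊n/2⌋+⌈n/2⌉≡n r))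

⌊4r/8⌋≡⌊r/2⌋ : ∀ r → ⌊ ⌊ ⌊ (r + r) + (r + r) /2⌋ /2⌋ /2⌋ ≡ ⌊ r /2⌋
⌊4r/8⌋≡⌊r/2⌋ r =
  cong ⌊_/2⌋ (trans (cong ⌊_/2⌋ (≡.sym (ℕₚ.n≡⌊n+n/2⌋ (r + r)))) (≡.sym (ℕₚ.n≡⌊n+n/2⌋ r)))

k2^m2^m2^m≤k2^6m : ∀ k m → ((k * 2 ^ m) * 2 ^ m) * 2 ^ m ≤ k * 2 ^ (6 * m)
k2^m2^m2^m≤k2^6m k m = begin
  ((k * 2 ^ m) * 2 ^ m) * 2 ^ m ≡⟨ cube k (2 ^ m) ⟩
  k * (2 ^ m) ^ 3               ≡⟨ cong (k *_) (ℕₚ.^-*-assoc 2 m 3) ⟩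
  k * 2 ^ (m * 3)               ≤⟨ ℕₚ.*-monoʳ-≤ k (ℕₚ.^-monoʳ-≤ 2 m*3≤6*m) ⟩
  k * 2 ^ (6 * m)               ∎
  where
  open ℕₚ.≤-Reasoning
  cube : ∀ k x → ((k * x) * x) * x ≡ k * (x * (x * (x * 1)))
  cube = solve-∀
  m*3≤6*m : m * 3 ≤ 6 * m
  m*3≤6*m = ℕₚ.≤-trans (ℕₚ.≤-reflexive (ℕₚ.*-comm m 3)) (ℕₚ.*-monoˡ-≤ m (ℕₚ.m≤m+n 3 3))

module DistanceGraph (G : Graph) (r : ℕ) (I : Subset (n G)) where

  adjᴴ : Fin (n G) → Fin (n G) → Bool
  adjᴴ u v = does (DistLe? G u v (3 * r))

  adjᴴ-sym : ∀ u v → adjᴴ u v ≡ adjᴴ v u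
  adjᴴ-sym u v =
    does-⇔ (mk⇔ (DistLe-sym G) (DistLe-sym G)) (DistLe? G u v (3 * r)) (DistLe? G v u (3 * r))

  edge⇒adjᴴ : ∀ {u v} → DistGraphEdge G r 3 u v → adjᴴ u v ≡ true
  edge⇒adjᴴ {u} {v} = dec-true (DistLe? G u v _)

  module Separator (m k : ℕ) (doubling : DoublingDimAtMost G m) (independent : DistIndependent G r I)
                   (W X : Subset (n G)) (cs : List (Fin (n G))) (length≤k : length cs ≤ k)
                   (X-covered : CoveredBy G cs r (_∈ X))
                   (X-balanced : IsBalancedSeparator G (indicator W) X) where

    4r : ℕ
    4r = (r + r) + (r + r)

    near? : ∀ v → Dec (v ∈ I × Any (λ c → DistLe G c v 4r) cs)
    near? v = (v ∈? I) ×-dec Any.any? (λ c → DistLe? G c v 4r) cs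

    S : Subset (n G)
    S = subset near?

    near-X⇒∈S : ∀ {u y d} → d ≤ 3 * r → DistLe G u y d → y ∈ X → u ∈ I → u ∈ S
    near-X⇒∈S {u} {y} {d} d≤3r u~y y∈X u∈I with X-covered y y∈X
    ... | c , c∈cs , c~y = ∈-subset⁺ near? (u∈I , lose c∈cs c~u)
      where
      r+3r≡4r : ∀ r → r + 3 * r ≡ (r + r) + (r + r)
      r+3r≡4r = solve-∀
      c~u : DistLe G c u 4r
      c~u = DistLe-mono G (ℕₚ.≤-reflexive (r+3r≡4r r))
              (DistLe-trans G c~y (DistLe-mono G d≤3r (DistLe-sym G u~y)))

    ∈I─S⇒∉X : ∀ {v} → v ∈ I ─ S → v ∉ X
    ∈I─S⇒∉X {v} v∈I─S v∈X =
      x∈p─q⇒x∉q I S v∈I─S (near-X⇒∈S z≤n (DistLe-refl G v) v∈X (p─q⊆p I S v∈I─S))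

    S-covered : CoveredBy G cs 4r (_∈ S)
    S-covered v v∈S = find (proj₂ (∈-subset⁻ near? v∈S))

    S-sparse : ∀ c {u v} → DistLe G c u ⌊ r /2⌋ → DistLe G c v ⌊ r /2⌋ → u ∈ S → v ∈ S → u ≡ v
    S-sparse c {u} {v} c~u c~v u∈S v∈S = decidable-stable (u Fin.≟ v) λ u≢v →
      independent u v (proj₁ (∈-subset⁻ near? u∈S)) (proj₁ (∈-subset⁻ near? v∈S)) u≢v
        (DistLe-mono G (⌊r/2⌋+⌊r/2⌋≤r r) (DistLe-trans G (DistLe-sym G c~u) c~v))

    ∣S∣≤ : ∣ S ∣ ≤ k * 2 ^ (6 * m)
    ∣S∣≤ with refine G m doubling cs 4r S-covered
    ... | cs₁ , length₁ , covered₁ with refine G m doubling cs₁ _ covered₁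
    ... | cs₂ , length₂ , covered₂ with refine G m doubling cs₂ _ covered₂
    ... | cs₃ , length₃ , covered₃ = begin
      ∣ S ∣                                    ≤⟨ ∣X∣≤length-centres (λ c v → DistLe G c v ⌊ r /2⌋)
                                                    (λ c v → DistLe? G c v _) cs₃ S
                                                    (subst (λ d → CoveredBy G cs₃ d (_∈ S))
                                                           (⌊4r/8⌋≡⌊r/2⌋ r) covered₃)
                                                    S-sparse ⟩
      length cs₃                               ≤⟨ length₃ ⟩
      length cs₂ * 2 ^ m                       ≤⟨ ℕₚ.*-monoˡ-≤ (2 ^ m) length₂ ⟩
      (length cs₁ * 2 ^ m) * 2 ^ m             ≤⟨ ℕₚ.*-monoˡ-≤ (2 ^ m) (ℕₚ.*-monoˡ-≤ (2 ^ m) length₁) ⟩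
      ((length cs * 2 ^ m) * 2 ^ m) * 2 ^ m    ≤⟨ ℕₚ.*-monoˡ-≤ (2 ^ m) (ℕₚ.*-monoˡ-≤ (2 ^ m)
                                                    (ℕₚ.*-monoˡ-≤ (2 ^ m) length≤k)) ⟩
      ((k * 2 ^ m) * 2 ^ m) * 2 ^ m            ≤⟨ k2^m2^m2^m≤k2^6m k m ⟩
      k * 2 ^ (6 * m)                          ∎
      where
      open ℕₚ.≤-Reasoning

    H-walk⇒G-walk : ∀ {u v ℓ} → WalkIn adjᴴ (_∈ I ─ S) u v ℓ → ∃[ ℓ′ ] WalkIn (adj G) (_∈ ∁ X) u v ℓ′
    H-walk⇒G-walk (here u∈I─S) = 0 , here (x∉p⇒x∈∁p (∈I─S⇒∉X u∈I─S))
    H-walk⇒G-walk {u} (step u∈I─S e p) with does≡true⇒ (DistLe? G u _ (3 * r)) e | H-walk⇒G-walk p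
    ... | ℓ , ℓ≤3r , q | ℓ′ , q′ = ℓ + ℓ′ , walk-++ (walk-weaken avoids-X (walk⇒DistLe-along G q)) q′
      where
      avoids-X : ∀ {y} → DistLe G u y ℓ → y ∈ ∁ X
      avoids-X u~y = x∉p⇒x∈∁p λ y∈X →
        x∈p─q⇒x∉q I S u∈I─S (near-X⇒∈S ℓ≤3r u~y y∈X (p─q⊆p I S u∈I─S))

    reach⊆component : ∀ {x C Gc} → (∀ v → v ∈ C → ∃[ ℓ ] WalkIn adjᴴ (_∈ I ─ S) x v ℓ) →
                      Component (adj G) (∁ X) x Gc → W ∩ C ⊆ W ∩ Gc
    reach⊆component reach piece w∈W∩C with x∈p∩q⁻ W _ w∈W∩C
    ... | w∈W , w∈C with reach _ w∈C
    ...   | _ , p with H-walk⇒G-walk p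
    ...     | _ , q =
      x∈p∩q⁺ (w∈W , walk-last (walk-closed (Component.closed piece) q (Component.x∈C piece)))

    balanced : Balanced adjᴴ (I ─ S) W
    balanced x C reach with nonempty? C
    ... | no C-empty = ℕₚ.≤-trans (ℕₚ.*-monoʳ-≤ 2 ∣W∩C∣≤0) z≤n
      where
      ∣W∩C∣≤0 : ∣ W ∩ C ∣ ≤ 0
      ∣W∩C∣≤0 = ℕₚ.≤-trans (∣p∩q∣≤∣q∣ W C)
                  (ℕₚ.≤-reflexive (trans (cong ∣_∣ (Empty-unique C-empty)) (∣⊥∣≡0 (n G))))
    ... | yes (v , v∈C) with component (adj G) (∁ X) (x∉p⇒x∈∁p (∈I─S⇒∉X (walk-head (proj₂ (reach v v∈C)))))
    ...   | Gc , piece = ℕₚ.≤-trans (ℕₚ.*-monoʳ-≤ 2 (p⊆q⇒∣p∣≤∣q∣ (reach⊆component reach piece)))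
                           (indicator-half W Gc (X-balanced Gc (Component⇒IsComponentOf- G piece)))

  H-separator : ∀ m k → DoublingDimAtMost G m → BalSepNumAtMost G r k → DistIndependent G r I →
                ∀ W → ∃[ S ] (∣ S ∣ ≤ k * 2 ^ (6 * m) × Balanced adjᴴ (I ─ S) W)
  H-separator m k doubling separators independent W with separators (indicator W) (indicator-nonneg W)
  ... | X , (cs , length≤k , X-covered) , X-balanced = S , ∣S∣≤ , balanced
    where open Separator m k doubling independent W X cs length≤k X-covered X-balanced

lemma4p1 : (m : ℕ) (G : Graph) → DoublingDimAtMost G m →
    (r k : ℕ) → 1 ≤ r → BalSepNumAtMost G r k →
    (I : Subset (n G)) → MaximalDistIndependent G r I →
    TreewidthAtMost I (DistGraphEdge G r 3) (3 * k * 2 ^ (6 * m))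
lemma4p1 m G doubling r k _ separators I (independent , _) =
  subst (TreeDecomposition I (DistGraphEdge G r 3)) (≡.sym (ℕₚ.*-assoc 3 k (2 ^ (6 * m))))
    (SeparatorsToTreeDecomposition.treeDecomposition I adjᴴ adjᴴ-sym (DistGraphEdge G r 3) edge⇒adjᴴ
      (k * 2 ^ (6 * m)) (H-separator m k doubling separators independent))
  where open DistanceGraph G r I
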